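{- Let T1 be the Hilbert system described in the context, and let T1$'$ be the system obtained from T1 by replacing the identity axiom scheme (L) with the scheme (L*) $x=y\rightarrow(A(x,x)\rightarrow A(x,y))$, restricted to atomic formulas $A$, where $A(x,y)$ results from $A(x,x)$ by replacing some free occurrences of $x$ by $y$, $y$ being free for $x$ at those positions. Then T1 and T1$'$ are equivalent, i.e. they have the same theorems.
   Context: The language $L^\omega$ has countably many variables, countably many $n$-ary predicate symbols including a distinguished binary predicate $=$, connectives $\&,\sim$, the quantifier $\exists$ (with $\rightarrow,\leftrightarrow,\vee,\forall$ defined as usual), and an intensional abstraction operator. Terms and formulas are defined simultaneously: variables are terms; if $t_1,\dots,t_n$ are terms and $F$ is $n$-ary then $F(t_1,\dots,t_n)$ is a formula (an atomic formula); if $A,B$ are formulas and $v$ a variable then $(A\&B)$, $\sim A$, $\exists v. A$ are formulas; if $A$ is a formula and $v_1,\dots,v_m$ ($m\ge 0$) are distinct variables then $[A]_{v_1\dots v_m}$ is a term (variables $v_i$ are bound in it); write $[A]$ when $m=0$. Define $\square A :\equiv [A] = [[A]=[A]]$ and $\lozenge A :\equiv \sim\square\sim A$. The system T1 has the axioms: all tautologies; (Ins) $\forall v. A(v)\rightarrow A(t)$ for $t$ free for $v$ in $A$; (QImp) $\forall v.(A\rightarrow B)\rightarrow(A\rightarrow\forall v. B)$ for $v$ not free in $A$; (Id) $v=v$; (L) $v=w\rightarrow(A(v,v)\leftrightarrow A(v,w))$ for arbitrary formulas $A$, where $A(v,w)$ results from $A(v,v)$ by replacing some free occurrences of $v$ by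 $w$, $w$ being free for $v$ at those positions; $\sim [A]_{\bar x}=[B]_{\bar y}$ whenever $\bar x,\bar y$ have different lengths; $[A]_{\bar x}=[A']_{\bar x'}$ whenever these are alphabetic variants ($\alpha$-equivalence); (B) $[A]_{\bar x}=[B]_{\bar x}\leftrightarrow\square\forall\bar x.(A\leftrightarrow B)$; (T) $\square A\rightarrow A$; (K) $\square(A\rightarrow B)\rightarrow(\square A\rightarrow\square B)$; (S5) $\lozenge A\rightarrow\square\lozenge A$. Rules: (MP) from $A$ and $A\rightarrow B$ infer $B$; (N) from $A$ infer $\square A$; (Gen) from $A$ infer $\forall v. A$. -}

module Defs where

open import Data.Nat using (ℕ; zero; suc) renaming (_≡ᵇ_ to _==_)
open import Data.Bool using (Bool; true; false; _∧_; _∨_; not; if_then_else_)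
open import Data.List using (List; []; _∷_; _++_; length)
open import Data.Bool.ListAction using (any)
open import Data.List.Relation.Unary.Unique.Propositional using (Unique)
open import Data.Vec using (Vec; []; _∷_)
open import Data.Maybe using (Maybe; just; nothing)
open import Data.Sum using (_⊎_)
open import Relation.Binary.PropositionalEquality using (_≡_)
open import Relation.Nullary using (¬_)

-- Predicate symbols:
-- for every arity n countably many symbols (indexed by ℕ), plus the
-- distinguished binary predicate "=" (constructor _≐_).
-- [A]_{v1..vm} is  abs (v1 ∷ … ∷ vm ∷ []) p A  with p a proof that the
-- v_i are distinct.

data Term : Set
data Formula : Set

data Term where
  var : ℕ → Term
  abs : (vs : List ℕ) → Unique vs → Formula → Term

data Formula where
  atom : (n : ℕ) → (i : ℕ) → Vec Term n → Formula
  _≐_  : Term → Term → Formula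
  _&_  : Formula → Formula → Formula
  ~_   : Formula → Formula
  ∃'   : ℕ → Formula → Formula

infix  8 _≐_
infixr 6 _&_
infix  9 ~_

infixr 4 _⇒_
infix  3 _⇔'_
_⇒_ : Formula → Formula → Formula
A ⇒ B = ~ (A & ~ B)

_∨'_ : Formula → Formula → Formula
A ∨' B = ~ (~ A & ~ B)

_⇔'_ : Formula → Formula → Formula
A ⇔' B = (A ⇒ B) & (B ⇒ A)

∀' : ℕ → Formula → Formula
∀' v A = ~ ∃' v (~ A)

∀* : List ℕ → Formula → Formula
∀* [] A = A
∀* (v ∷ vs) A = ∀' v (∀* vs A)

⟦_⟧ : Formula → Term
⟦ A ⟧ = abs [] Unique.[] A

□ : Formula → Formula
□ A = ⟦ A ⟧ ≐ ⟦ ⟦ A ⟧ ≐ ⟦ A ⟧ ⟧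

◇ : Formula → Formula
◇ A = ~ □ (~ A)

-- Tautologies: truth-functional tautologies (formulas whose main
-- structure is & and ~, true under every assignment of truth values
-- to the prime formulas, i.e. atomic and existential formulas).

eval : (Formula → Bool) → Formula → Bool
eval V (A & B) = eval V A ∧ eval V B
eval V (~ A)   = not (eval V A)
eval V A       = V A

Tautology : Formula → Set
Tautology A = (V : Formula → Bool) → eval V A ≡ true

_∈ᵇ_ : ℕ → List ℕ → Bool
x ∈ᵇ [] = false
x ∈ᵇ (y ∷ ys) = (x == y) ∨ (x ∈ᵇ ys)

freeT  : ℕ → Term → Bool
freeTs : ∀ {n} → ℕ → Vec Term n → Bool
freeF  : ℕ → Formula → Bool
freeT x (var y) = x == y
freeT x (abs vs _ A) = not (x ∈ᵇ vs) ∧ freeF x A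
freeTs x [] = false
freeTs x (t ∷ ts) = freeT x t ∨ freeTs x ts
freeF x (atom n i ts) = freeTs x ts
freeF x (s ≐ t) = freeT x s ∨ freeT x t
freeF x (A & B) = freeF x A ∨ freeF x B
freeF x (~ A) = freeF x A
freeF x (∃' u A) = not (x == u) ∧ freeF x A

-- substitution of t for the free occurrences of v (no renaming)
substT  : Term → ℕ → Term → Term
substTs : ∀ {n} → Term → ℕ → Vec Term n → Vec Term n
substF  : Term → ℕ → Formula → Formula
substT t v (var x) = if x == v then t else var x
substT t v (abs vs p A) = if v ∈ᵇ vs then abs vs p A else abs vs p (substF t v A)
substTs t v [] = []
substTs t v (s ∷ ss) = substT t v s ∷ substTs t v ss
substF t v (atom n i ts) = atom n i (substTs t v ts)
substF t v (s ≐ s') = substT t v s ≐ substT t v s'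
substF t v (A & B) = substF t v A & substF t v B
substF t v (~ A) = ~ substF t v A
substF t v (∃' u A) = if u == v then ∃' u A else ∃' u (substF t v A)

-- ffT t v bs s : no free occurrence of v in s (free relative to the
-- enclosing binders bs) lies in the scope of a binder in bs of a
-- variable free in t.
ffT  : Term → ℕ → List ℕ → Term → Bool
ffTs : ∀ {n} → Term → ℕ → List ℕ → Vec Term n → Bool
ffF  : Term → ℕ → List ℕ → Formula → Bool
ffT t v bs (var x) =
  if (x == v) ∧ not (x ∈ᵇ bs) then not (any (λ y → freeT y t) bs) else true
ffT t v bs (abs vs _ A) = ffF t v (vs ++ bs) A
ffTs t v bs [] = true
ffTs t v bs (s ∷ ss) = ffT t v bs s ∧ ffTs t v bs ss
ffF t v bs (atom n i ts) = ffTs t v bs ts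
ffF t v bs (s ≐ s') = ffT t v bs s ∧ ffT t v bs s'
ffF t v bs (A & B) = ffF t v bs A ∧ ffF t v bs B
ffF t v bs (~ A) = ffF t v bs A
ffF t v bs (∃' u A) = ffF t v (u ∷ bs) A

FreeFor : Term → ℕ → Formula → Set
FreeFor t v A = ffF t v [] A ≡ true

-- Replacing some free occurrences of v by w (w free for v there).
-- bs = variables bound by the enclosing binders.

_∉_ : ℕ → List ℕ → Set
x ∉ bs = x ∈ᵇ bs ≡ false

data ReplT  (v w : ℕ) (bs : List ℕ) : Term → Term → Set
data ReplTs (v w : ℕ) (bs : List ℕ) : ∀ {n} → Vec Term n → Vec Term n → Set
data ReplF  (v w : ℕ) (bs : List ℕ) : Formula → Formula → Set

data ReplT v w bs where
  keep : ∀ x → ReplT v w bs (var x) (var x)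
  swap : v ∉ bs → w ∉ bs → ReplT v w bs (var v) (var w)
  abs  : ∀ vs p {A A'} → ReplF v w (vs ++ bs) A A' →
         ReplT v w bs (abs vs p A) (abs vs p A')

data ReplTs v w bs where
  []  : ReplTs v w bs [] []
  _∷_ : ∀ {n s s'} {ss ss' : Vec Term n} → ReplT v w bs s s' →
        ReplTs v w bs ss ss' → ReplTs v w bs (s ∷ ss) (s' ∷ ss')

data ReplF v w bs where
  atom : ∀ n i {ts ts'} → ReplTs v w bs ts ts' →
         ReplF v w bs (atom n i ts) (atom n i ts')
  eq   : ∀ {s s' t t'} → ReplT v w bs s s' → ReplT v w bs t t' →
         ReplF v w bs (s ≐ t) (s' ≐ t')
  and  : ∀ {A A' B B'} → ReplF v w bs A A' → ReplF v w bs B B' →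
         ReplF v w bs (A & B) (A' & B')
  neg  : ∀ {A A'} → ReplF v w bs A A' → ReplF v w bs (~ A) (~ A')
  ex   : ∀ u {A A'} → ReplF v w (u ∷ bs) A A' →
         ReplF v w bs (∃' u A) (∃' u A')

Repl : ℕ → ℕ → Formula → Formula → Set
Repl v w A A' = ReplF v w [] A A'

data Atomic : Formula → Set where
  atom : ∀ n i ts → Atomic (atom n i ts)
  eq   : ∀ s t → Atomic (s ≐ t)

-- Alphabetic variants (α-equivalence).  Γ, Δ: enclosing binders,
-- innermost first; a variable is matched by the position of its
-- innermost binder, free variables must coincide.

index : ℕ → List ℕ → Maybe ℕ
index x [] = nothing
index x (y ∷ ys) = if x == y then just zero else Data.Maybe.map suc (index x ys)

data AlphaT  (Γ Δ : List ℕ) : Term → Term → Set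
data AlphaTs (Γ Δ : List ℕ) : ∀ {n} → Vec Term n → Vec Term n → Set
data AlphaF  (Γ Δ : List ℕ) : Formula → Formula → Set

data AlphaT Γ Δ where
  bound : ∀ {x y k} → index x Γ ≡ just k → index y Δ ≡ just k →
          AlphaT Γ Δ (var x) (var y)
  free  : ∀ {x} → index x Γ ≡ nothing → index x Δ ≡ nothing →
          AlphaT Γ Δ (var x) (var x)
  abs   : ∀ {vs ws p q A B} → length vs ≡ length ws →
          AlphaF (vs ++ Γ) (ws ++ Δ) A B →
          AlphaT Γ Δ (abs vs p A) (abs ws q B)

data AlphaTs Γ Δ where
  []  : AlphaTs Γ Δ [] []
  _∷_ : ∀ {n s s'} {ss ss' : Vec Term n} → AlphaT Γ Δ s s' →
        AlphaTs Γ Δ ss ss' → AlphaTs Γ Δ (s ∷ ss) (s' ∷ ss')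

data AlphaF Γ Δ where
  atom : ∀ n i {ts ts'} → AlphaTs Γ Δ ts ts' →
         AlphaF Γ Δ (atom n i ts) (atom n i ts')
  eq   : ∀ {s s' t t'} → AlphaT Γ Δ s s' → AlphaT Γ Δ t t' →
         AlphaF Γ Δ (s ≐ t) (s' ≐ t')
  and  : ∀ {A A' B B'} → AlphaF Γ Δ A A' → AlphaF Γ Δ B B' →
         AlphaF Γ Δ (A & B) (A' & B')
  neg  : ∀ {A A'} → AlphaF Γ Δ A A' → AlphaF Γ Δ (~ A) (~ A')
  ex   : ∀ {u u' A A'} → AlphaF (u ∷ Γ) (u' ∷ Δ) A A' →
         AlphaF Γ Δ (∃' u A) (∃' u' A')

data CommonAx : Formula → Set where
  taut : ∀ {A} → Tautology A → CommonAx A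
  ins  : ∀ v t A → FreeFor t v A → CommonAx (∀' v A ⇒ substF t v A)
  qimp : ∀ v A B → freeF v A ≡ false →
         CommonAx (∀' v (A ⇒ B) ⇒ (A ⇒ ∀' v B))
  id   : ∀ v → CommonAx (var v ≐ var v)
  len  : ∀ xs p A ys q B → ¬ (length xs ≡ length ys) →
         CommonAx (~ (abs xs p A ≐ abs ys q B))
  alpha : ∀ xs p A ys q B → AlphaT [] [] (abs xs p A) (abs ys q B) →
         CommonAx (abs xs p A ≐ abs ys q B)
  axB  : ∀ xs p q A B →
         CommonAx ((abs xs p A ≐ abs xs q B) ⇔' □ (∀* xs (A ⇔' B)))
  axT  : ∀ A → CommonAx (□ A ⇒ A)
  axK  : ∀ A B → CommonAx (□ (A ⇒ B) ⇒ (□ A ⇒ □ B))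
  axS5 : ∀ A → CommonAx (◇ A ⇒ □ (◇ A))

data AxL : Formula → Set where
  L : ∀ v w A A' → Repl v w A A' → AxL (var v ≐ var w ⇒ (A ⇔' A'))

data AxL* : Formula → Set where
  L* : ∀ v w A A' → Atomic A → Repl v w A A' →
       AxL* (var v ≐ var w ⇒ (A ⇒ A'))

AxT1 : Formula → Set
AxT1 A = CommonAx A ⊎ AxL A

AxT1' : Formula → Set
AxT1' A = CommonAx A ⊎ AxL* A

data _⊢_ (Ax : Formula → Set) : Formula → Set where
  ax  : ∀ {A} → Ax A → Ax ⊢ A
  mp  : ∀ {A B} → Ax ⊢ A → Ax ⊢ (A ⇒ B) → Ax ⊢ B
  nec : ∀ {A} → Ax ⊢ A → Ax ⊢ □ A
  gen : ∀ {A} v → Ax ⊢ A → Ax ⊢ ∀' v A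

infix 2 _⊢_

-- (L*) is (L) weakened propositionally, so T1' ⊆ T1.  Conversely, given
-- v = w and a replacement A ↦ A', the atomic instance of (L*) for the
-- formula [A] = [A], replacing inside the second abstract, turns the
-- reflexivity [A] = [A] into [A] = [A'].  By (B) with m = 0 this is
-- □(A ↔ A'), and (T) yields A ↔ A'; so every instance of (L) is
-- derivable in T1'.
module Submission where

open import Defs
open import Function.Bundles using (_⇔_; mk⇔)
open import Data.Bool using (Bool; true; false; _∧_; not)
open import Data.Sum using (_⊎_; inj₁; inj₂)
open import Data.List using ([])
open import Data.Vec using (Vec; []; _∷_)
open import Data.List.Relation.Unary.Unique.Propositional using (Unique)
open import Relation.Binary.PropositionalEquality using (_≡_; refl)

⊢-translate : ∀ {Ax Ax′ : Formula → Set} → (∀ {A} → Ax A → Ax′ ⊢ A) →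
              ∀ {A} → Ax ⊢ A → Ax′ ⊢ A
⊢-translate f (ax a)    = f a
⊢-translate f (mp d e)  = mp (⊢-translate f d) (⊢-translate f e)
⊢-translate f (nec d)   = nec (⊢-translate f d)
⊢-translate f (gen v d) = gen v (⊢-translate f d)

replT-refl  : ∀ v w bs (t : Term) → ReplT v w bs t t
replTs-refl : ∀ v w bs {n} (ts : Vec Term n) → ReplTs v w bs ts ts
replF-refl  : ∀ v w bs (A : Formula) → ReplF v w bs A A
replT-refl v w bs (var x)      = keep x
replT-refl v w bs (abs vs p A) = abs vs p (replF-refl v w _ A)
replTs-refl v w bs []       = []
replTs-refl v w bs (t ∷ ts) = replT-refl v w bs t ∷ replTs-refl v w bs ts
replF-refl v w bs (atom n i ts) = atom n i (replTs-refl v w bs ts)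
replF-refl v w bs (s ≐ t)       = eq (replT-refl v w bs s) (replT-refl v w bs t)
replF-refl v w bs (A & B)       = and (replF-refl v w bs A) (replF-refl v w bs B)
replF-refl v w bs (~ A)         = neg (replF-refl v w bs A)
replF-refl v w bs (∃' u A)      = ex u (replF-refl v w _ A)

_⇒ᵇ_ : Bool → Bool → Bool
a ⇒ᵇ b = not (a ∧ not b)

∧-elimˡ-⇒ᵇ : ∀ a b → (a ∧ b) ⇒ᵇ a ≡ true
∧-elimˡ-⇒ᵇ true  true  = refl
∧-elimˡ-⇒ᵇ true  false = refl
∧-elimˡ-⇒ᵇ false b     = refl

⇒ᵇ-trans : ∀ a b c → (a ⇒ᵇ b) ⇒ᵇ ((b ⇒ᵇ c) ⇒ᵇ (a ⇒ᵇ c)) ≡ true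
⇒ᵇ-trans true  true  true  = refl
⇒ᵇ-trans true  true  false = refl
⇒ᵇ-trans true  false c     = refl
⇒ᵇ-trans false true  true  = refl
⇒ᵇ-trans false true  false = refl
⇒ᵇ-trans false false true  = refl
⇒ᵇ-trans false false false = refl

⇒ᵇ-exchange : ∀ a b c → (a ⇒ᵇ (b ⇒ᵇ c)) ⇒ᵇ (b ⇒ᵇ (a ⇒ᵇ c)) ≡ true
⇒ᵇ-exchange true  true  true  = refl
⇒ᵇ-exchange true  true  false = refl
⇒ᵇ-exchange true  false c     = refl
⇒ᵇ-exchange false true  true  = refl
⇒ᵇ-exchange false true  false = refl
⇒ᵇ-exchange false false c     = refl

module CommonRules (Extra : Formula → Set) where

  Ax : Formula → Set
  Ax A = CommonAx A ⊎ Extra A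

  common : ∀ {A} → CommonAx A → Ax ⊢ A
  common c = ax (inj₁ c)

  ⇒-trans : ∀ {A B C} → Ax ⊢ A ⇒ B → Ax ⊢ B ⇒ C → Ax ⊢ A ⇒ C
  ⇒-trans {A} {B} {C} ab bc =
    mp bc (mp ab (common (taut λ V → ⇒ᵇ-trans (eval V A) (eval V B) (eval V C))))

  ⇒-exchange : ∀ {A B C} → Ax ⊢ A ⇒ (B ⇒ C) → Ax ⊢ B ⇒ (A ⇒ C)
  ⇒-exchange {A} {B} {C} abc =
    mp abc (common (taut λ V → ⇒ᵇ-exchange (eval V A) (eval V B) (eval V C)))

  ⇔-to-⇒ : ∀ {A B} → Ax ⊢ (A ⇔' B) ⇒ (A ⇒ B)
  ⇔-to-⇒ {A} {B} = common (taut λ V → ∧-elimˡ-⇒ᵇ (eval V (A ⇒ B)) (eval V (B ⇒ A)))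

  ≐-refl : ∀ t → Ax ⊢ t ≐ t
  ≐-refl t = mp (gen 0 (common (id 0))) (common (ins 0 t (var 0 ≐ var 0) refl))

L*-in-T1 : ∀ {A} → AxL* A → AxT1 ⊢ A
L*-in-T1 (L* v w A A′ _ r) = ⇒-trans (ax (inj₂ (L v w A A′ r))) ⇔-to-⇒
  where open CommonRules AxL

L-in-T1′ : ∀ {A} → AxL A → AxT1' ⊢ A
L-in-T1′ (L v w A A′ r) = ⇒-trans v≐w⇒[A]≐[A′] (⇒-trans [A]≐[A′]⇒□A⇔A′ □A⇔A′⇒A⇔A′)
  where
  open CommonRules AxL*

  v≐w⇒[A]≐[A]⇒[A]≐[A′] : AxT1' ⊢ var v ≐ var w ⇒ (⟦ A ⟧ ≐ ⟦ A ⟧ ⇒ ⟦ A ⟧ ≐ ⟦ A′ ⟧)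
  v≐w⇒[A]≐[A]⇒[A]≐[A′] = ax (inj₂ (L* v w _ _ (eq ⟦ A ⟧ ⟦ A ⟧)
    (eq (replT-refl v w [] ⟦ A ⟧) (abs [] Unique.[] r))))

  v≐w⇒[A]≐[A′] : AxT1' ⊢ var v ≐ var w ⇒ ⟦ A ⟧ ≐ ⟦ A′ ⟧
  v≐w⇒[A]≐[A′] = mp (≐-refl ⟦ A ⟧) (⇒-exchange v≐w⇒[A]≐[A]⇒[A]≐[A′])

  [A]≐[A′]⇒□A⇔A′ : AxT1' ⊢ ⟦ A ⟧ ≐ ⟦ A′ ⟧ ⇒ □ (A ⇔' A′)
  [A]≐[A′]⇒□A⇔A′ = mp (common (axB [] Unique.[] Unique.[] A A′)) ⇔-to-⇒

  □A⇔A′⇒A⇔A′ : AxT1' ⊢ □ (A ⇔' A′) ⇒ (A ⇔' A′)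
  □A⇔A′⇒A⇔A′ = common (axT (A ⇔' A′))

T1′-axioms-in-T1 : ∀ {A} → AxT1' A → AxT1 ⊢ A
T1′-axioms-in-T1 (inj₁ c) = ax (inj₁ c)
T1′-axioms-in-T1 (inj₂ l) = L*-in-T1 l

T1-axioms-in-T1′ : ∀ {A} → AxT1 A → AxT1' ⊢ A
T1-axioms-in-T1′ (inj₁ c) = ax (inj₁ c)
T1-axioms-in-T1′ (inj₂ l) = L-in-T1′ l

lemma1p25 : (A : Formula) → (AxT1 ⊢ A) ⇔ (AxT1' ⊢ A)
lemma1p25 A = mk⇔ (⊢-translate T1-axioms-in-T1′) (⊢-translate T1′-axioms-in-T1)
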